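{- Let $Z \subseteq \overline{\mathbb{F}}$ be a floating-point interval, and let $x \in \mathbb{F}^*$ and $z \in Z$. If $|z/x| \le \max\mathbb{F}$ and $\operatorname{diam}\mathrm{fl}^{ -1}[Z] > |x|\beta^{Q(z/x)}$, then $x$ is feasible for $Z$.
   Context: Floating-point format: integers $\beta \ge 2$, $p \ge 1$, $e_{\min} \le e_{\max}$. $\mathbb{F}^* = \{M\beta^{e-p+1} : M,e \in \mathbb{Z},\ 0<|M|<\beta^p,\ e_{\min}\le e\le e_{\max}\}$, $\mathbb{F} = \mathbb{F}^*\cup\{0\}$, $\overline{\mathbb{F}} = \mathbb{F}\cup\{ -\infty,+\infty\}$. For real $x$: $E(x) = \lfloor \log_\beta |x|\rfloor$ if $|x| \ge \beta^{e_{\min}}$, else $E(x) = e_{\min}$; $Q(x) = E(x)-p+1$. $\mathrm{RD}(x) = \max\{y\in\overline{\mathbb{F}} : y \le x\}$, $\mathrm{RU}(x) = \min\{y \in \overline{\mathbb{F}} : y \ge x\}$. $\mathrm{fl}:\overline{\mathbb{R}}\to\overline{\mathbb{F}}$ is a fixed nondecreasing rounding function with $\mathrm{fl}(x)\in\{\mathrm{RD}(x),\mathrm{RU}(x)\}$ for all $x$; $x\otimes y = \mathrm{fl}(xy)$ whenever the product is defined. $\operatorname{diam} X = \sup(\{d(a,b): a,b\in X\}\cup\{0\})$ with $d(a,b)=0$ if $a=b$ and $|a-b|$ otherwise. A floating-point interval is a set $X\cap\overline{\mathbb{F}}$ with $X$ an extended-real interval. $x$ is feasible for $Z$ if $x\otimes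 y\in Z$ for some $y\in\overline{\mathbb{F}}$.
   Formalization: The rounding function fl is defined on the extended rationals rather than on $\overline{\mathbb{R}}$, so its preimage $\mathrm{fl}^{ -1}[Z]$ and the interval X defining Z consist of extended rationals. -}

module Defs where

open import Data.Nat as ℕ using (ℕ; zero; suc; NonZero; >-nonZero)
open import Data.Nat.Properties as ℕP using (m^n≢0)
open import Data.Integer as ℤ using (ℤ; +_; -[1+_])
open import Data.Rational as ℚ using (ℚ; mkℚ; _≤_; _<_; _*_; _-_; ∣_∣; 0ℚ; 1/_)
open import Data.Product using (Σ; _×_)
open import Data.Sum using (_⊎_)
open import Data.Unit using (⊤)
open import Data.Empty using (⊥)
open import Relation.Binary.PropositionalEquality using (_≡_)
open import Relation.Nullary using (yes; no)

data ℚ̄ : Set where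
  -∞ +∞ : ℚ̄
  fin    : ℚ → ℚ̄

infix 4 _≤̄_ _<̄_

data _≤̄_ : ℚ̄ → ℚ̄ → Set where
  -∞≤    : ∀ {a} → -∞ ≤̄ a
  ≤+∞    : ∀ {a} → a ≤̄ +∞
  fin≤   : ∀ {a b} → a ≤ b → fin a ≤̄ fin b

data _<̄_ : ℚ̄ → ℚ̄ → Set where
  -∞<fin : ∀ {a} → -∞ <̄ fin a
  -∞<+∞  : -∞ <̄ +∞
  fin<+∞ : ∀ {a} → fin a <̄ +∞
  fin<   : ∀ {a b} → a < b → fin a <̄ fin b

∣_∣̄ : ℚ̄ → ℚ̄
∣ -∞ ∣̄    = +∞
∣ +∞ ∣̄    = +∞
∣ fin a ∣̄ = fin ∣ a ∣

-- reciprocal on ℚ, junk value 0 at 0 (only ever used at nonzero arguments)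
recip : ℚ → ℚ
recip b@(mkℚ (+ zero) _ _)  = 0ℚ
recip b@(mkℚ (+ suc n) _ _) = 1/ b
recip b@(mkℚ -[1+ n ] _ _)  = 1/ b

-- z / x for z ∈ ℚ̄ and x a (nonzero) rational; junk if x = 0
infixl 7 _/̄_
_/̄_ : ℚ̄ → ℚ → ℚ̄
fin a /̄ x = fin (a * recip x)
+∞ /̄ x with 0ℚ ℚ.<? x
... | yes _ = +∞
... | no  _ = -∞
-∞ /̄ x with 0ℚ ℚ.<? x
... | yes _ = -∞
... | no  _ = +∞

-- the product relation on ℚ̄ (the product is defined except for 0·(±∞))
data Prod : ℚ̄ → ℚ̄ → ℚ̄ → Set where
  fin×fin : ∀ {a b} → Prod (fin a) (fin b) (fin (a * b))
  pos×+∞  : ∀ {a} → 0ℚ < a → Prod (fin a) +∞ +∞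
  neg×+∞  : ∀ {a} → a < 0ℚ → Prod (fin a) +∞ -∞
  pos×-∞  : ∀ {a} → 0ℚ < a → Prod (fin a) -∞ -∞
  neg×-∞  : ∀ {a} → a < 0ℚ → Prod (fin a) -∞ +∞
  +∞×pos  : ∀ {a} → 0ℚ < a → Prod +∞ (fin a) +∞
  +∞×neg  : ∀ {a} → a < 0ℚ → Prod +∞ (fin a) -∞
  -∞×pos  : ∀ {a} → 0ℚ < a → Prod -∞ (fin a) -∞
  -∞×neg  : ∀ {a} → a < 0ℚ → Prod -∞ (fin a) +∞
  +∞×+∞   : Prod +∞ +∞ +∞
  +∞×-∞   : Prod +∞ -∞ -∞
  -∞×+∞   : Prod -∞ +∞ -∞
  -∞×-∞   : Prod -∞ -∞ +∞

dist : ℚ̄ → ℚ̄ → ℚ̄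
dist (fin a) (fin b) = fin ∣ a - b ∣
dist -∞ -∞ = fin 0ℚ
dist +∞ +∞ = fin 0ℚ
dist -∞ +∞ = +∞
dist -∞ (fin _) = +∞
dist +∞ -∞ = +∞
dist +∞ (fin _) = +∞
dist (fin _) -∞ = +∞
dist (fin _) +∞ = +∞

-- "diam S > c", where diam S = sup ({d(a,b) : a,b ∈ S} ∪ {0}):
-- a supremum exceeds c iff some element of the set exceeds c.
DiamGt : (ℚ̄ → Set) → ℚ → Set
DiamGt S c = (c < 0ℚ) ⊎ Σ ℚ̄ (λ a → Σ ℚ̄ (λ b → S a × S b × fin c <̄ dist a b))

IsInterval : (ℚ̄ → Set) → Set
IsInterval X = ∀ a b c → X a → X c → a ≤̄ b → b ≤̄ c → X b

record Format : Set where
  field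
    β        : ℕ
    2≤β      : 2 ℕ.≤ β
    p        : ℕ
    1≤p      : 1 ℕ.≤ p
    emin     : ℤ
    emax     : ℤ
    emin≤emax : emin ℤ.≤ emax

module Fmt (fmt : Format) where
  open Format fmt public

  instance
    β-nonZero : NonZero β
    β-nonZero = >-nonZero (ℕP.≤-trans (ℕ.s≤s ℕ.z≤n) 2≤β)

  pw : ℤ → ℚ
  pw (+ n)      = (+ (β ℕ.^ n)) ℚ./ 1
  pw -[1+ n ]   = ((+ 1) ℚ./ (β ℕ.^ suc n)) {{m^n≢0 β (suc n)}}

  IsFloatStar : ℚ → Set
  IsFloatStar x =
    Σ ℤ λ M → Σ ℤ λ e →
      0 ℕ.< ℤ.∣ M ∣ × ℤ.∣ M ∣ ℕ.< β ℕ.^ p ×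
      emin ℤ.≤ e × e ℤ.≤ emax ×
      x ≡ (M ℚ./ 1) * pw (e ℤ.- + p ℤ.+ + 1)

  InF : ℚ → Set
  InF x = IsFloatStar x ⊎ x ≡ 0ℚ

  InF̄ : ℚ̄ → Set
  InF̄ -∞      = ⊤
  InF̄ +∞      = ⊤
  InF̄ (fin x) = InF x

  IsMaxF : ℚ → Set
  IsMaxF m = InF m × (∀ f → InF f → f ≤ m)

  IsE : ℚ → ℤ → Set
  IsE x e = (pw emin ≤ ∣ x ∣ × pw e ≤ ∣ x ∣ × ∣ x ∣ < pw (e ℤ.+ + 1))
          ⊎ (∣ x ∣ < pw emin × e ≡ emin)

  IsĒ : ℚ̄ → ℤ → Set
  IsĒ (fin x) e = IsE x e
  IsĒ -∞ e = ⊥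
  IsĒ +∞ e = ⊥

  Qof : ℤ → ℤ
  Qof e = e ℤ.- + p ℤ.+ + 1

  IsRD : ℚ̄ → ℚ̄ → Set
  IsRD x y = InF̄ y × y ≤̄ x × (∀ w → InF̄ w → w ≤̄ x → w ≤̄ y)

  IsRU : ℚ̄ → ℚ̄ → Set
  IsRU x y = InF̄ y × x ≤̄ y × (∀ w → InF̄ w → x ≤̄ w → y ≤̄ w)

  IsRounding : (ℚ̄ → ℚ̄) → Set
  IsRounding fl = (∀ a b → a ≤̄ b → fl a ≤̄ fl b)
                × (∀ x → IsRD x (fl x) ⊎ IsRU x (fl x))

  IsFPInterval : (ℚ̄ → Set) → Set₁
  IsFPInterval Z = Σ (ℚ̄ → Set) λ X →
    IsInterval X × (∀ w → (Z w → X w × InF̄ w) × (X w × InF̄ w → Z w))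

  Feasible : (ℚ̄ → ℚ̄) → (ℚ̄ → Set) → ℚ̄ → Set
  Feasible fl Z x = Σ ℚ̄ λ y → InF̄ y × Σ ℚ̄ λ r → Prod x y r × Z (fl r)

-- The set P = {w ∈ ℚ : fl(w) ∈ Z} is order-convex, because fl is nondecreasing and Z is the trace of
-- an interval; it contains z, because fl fixes floating-point numbers. If diam fl⁻¹[Z] > |x| u with
-- u = β^Q(z/x), then either fl⁻¹[Z] contains ±∞ (and x ⊗ (±∞) works), or P contains a < b with
-- b − a > |x| u. The floating-point numbers y₁ ≤ z/x ≤ y₂ adjacent to z/x (which exist because
-- |z/x| ≤ max 𝔽) satisfy y₂ − y₁ ≤ u, so x y₁ and x y₂ bracket z within distance |x| u; one of them
-- therefore lies in [a, b] ⊆ P.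
module Submission where

open import Defs
open import Data.Nat as ℕ using (ℕ; zero; suc; NonZero)
import Data.Nat.Properties as ℕP
open import Data.Nat.Solver using (module +-*-Solver)
open import Data.Integer as ℤ using (ℤ; +_; -[1+_])
import Data.Integer.Properties as ℤP
import Data.Integer.Solver as ℤSolver
open import Data.Rational as ℚ using (ℚ; mkℚ; _≤_; _<_; _*_; _+_; _-_; -_; ∣_∣; 0ℚ; 1ℚ; _/_; toℚᵘ; *<*)
open import Data.Rational.Properties
import Data.Rational.Solver as ℚSolver
import Data.Rational.Unnormalised as ℚᵘ
import Data.Rational.Unnormalised.Properties as ℚᵘP
open import Data.Empty using (⊥-elim)
open import Data.Product using (Σ; _×_; _,_; proj₁; proj₂)
open import Data.Sum using (_⊎_; inj₁; inj₂; [_,_]′)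
open import Data.Unit using (tt)
open import Relation.Binary.PropositionalEquality
open import Relation.Nullary using (yes; no; ¬_)

module ℕS = +-*-Solver
module ℤS = ℤSolver.+-*-Solver
module ℚS = ℚSolver.+-*-Solver

toℚᵘ-/ : ∀ i n .{{_ : NonZero n}} → toℚᵘ (i / n) ℚᵘ.≃ (i ℚᵘ./ n)
toℚᵘ-/ i (suc k) = toℚᵘ-fromℚᵘ (ℚᵘ.mkℚᵘ i k)

/-≡ : ∀ i j a b .{{_ : NonZero a}} .{{_ : NonZero b}} → i ℤ.* + b ≡ j ℤ.* + a → i / a ≡ j / b
/-≡ i j (suc a) (suc b) eq = fromℚᵘ-cong {ℚᵘ.mkℚᵘ i a} {ℚᵘ.mkℚᵘ j b} (ℚᵘ.*≡* eq)

/-*-/ : ∀ i j a b .{{_ : NonZero a}} .{{_ : NonZero b}} →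
        (i / a) * (j / b) ≡ ((i ℤ.* j) / (a ℕ.* b)) {{ℕP.m*n≢0 a b}}
/-*-/ i j a@(suc _) b@(suc _) = toℚᵘ-injective (ℚᵘP.≃-trans (toℚᵘ-homo-* (i / a) (j / b))
  (ℚᵘP.≃-trans (ℚᵘP.*-cong (toℚᵘ-/ i a) (toℚᵘ-/ j b)) (ℚᵘP.≃-sym (toℚᵘ-/ (i ℤ.* j) (a ℕ.* b)))))

1/a*b≡1/c : ∀ a b c .{{_ : NonZero a}} .{{_ : NonZero c}} → b ℕ.* c ≡ a → (+ 1 / a) * (+ b / 1) ≡ + 1 / c
1/a*b≡1/c a b c b*c≡a = trans (/-*-/ (+ 1) (+ b) a 1) (/-≡ (+ 1 ℤ.* + b) (+ 1) (a ℕ.* 1) c {{ℕP.m*n≢0 a 1}} cross)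
  where
  open ≡-Reasoning
  cross : (+ 1 ℤ.* + b) ℤ.* + c ≡ + 1 ℤ.* + (a ℕ.* 1)
  cross = begin
    (+ 1 ℤ.* + b) ℤ.* + c  ≡⟨ cong (ℤ._* + c) (ℤP.*-identityˡ (+ b)) ⟩
    + b ℤ.* + c            ≡⟨ sym (ℤP.pos-* b c) ⟩
    + (b ℕ.* c)            ≡⟨ cong +_ (trans b*c≡a (sym (ℕP.*-identityʳ a))) ⟩
    + (a ℕ.* 1)            ≡⟨ sym (ℤP.*-identityˡ _) ⟩
    + 1 ℤ.* + (a ℕ.* 1)    ∎

fromℤ : ℤ → ℚ
fromℤ i = i / 1

fromℤ-homo-+ : ∀ i j → fromℤ (i ℤ.+ j) ≡ fromℤ i + fromℤ j
fromℤ-homo-+ i j = toℚᵘ-injective (ℚᵘP.≃-trans (toℚᵘ-/ (i ℤ.+ j) 1)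
  (ℚᵘP.≃-sym (ℚᵘP.≃-trans (toℚᵘ-homo-+ (fromℤ i) (fromℤ j))
    (ℚᵘP.≃-trans (ℚᵘP.+-cong (toℚᵘ-/ i 1) (toℚᵘ-/ j 1))
      (ℚᵘ.*≡* (cong₂ ℤ._*_ (cong₂ ℤ._+_ (ℤP.*-identityʳ i) (ℤP.*-identityʳ j)) refl))))))

fromℤ-homo-* : ∀ i j → fromℤ (i ℤ.* j) ≡ fromℤ i * fromℤ j
fromℤ-homo-* i j = sym (/-*-/ i j 1 1)

fromℤ-homo‿- : ∀ i → fromℤ (ℤ.- i) ≡ - fromℤ i
fromℤ-homo‿- i = toℚᵘ-injective (ℚᵘP.≃-trans (toℚᵘ-/ (ℤ.- i) 1)
  (ℚᵘP.≃-sym (ℚᵘP.≃-trans (toℚᵘ-homo‿- (fromℤ i)) (ℚᵘP.≃-trans (ℚᵘP.-‿cong (toℚᵘ-/ i 1)) (ℚᵘ.*≡* refl)))))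

fromℤ-mono-≤ : ∀ {i j} → i ℤ.≤ j → fromℤ i ≤ fromℤ j
fromℤ-mono-≤ {i} {j} i≤j = toℚᵘ-cancel-≤
  (ℚᵘP.≤-respˡ-≃ (ℚᵘP.≃-sym (toℚᵘ-/ i 1)) (ℚᵘP.≤-respʳ-≃ (ℚᵘP.≃-sym (toℚᵘ-/ j 1))
    (ℚᵘ.*≤* (subst₂ ℤ._≤_ (sym (ℤP.*-identityʳ i)) (sym (ℤP.*-identityʳ j)) i≤j))))

fromℤ-mono-< : ∀ {i j} → i ℤ.< j → fromℤ i < fromℤ j
fromℤ-mono-< {i} {j} i<j = toℚᵘ-cancel-<
  (ℚᵘP.<-respˡ-≃ (ℚᵘP.≃-sym (toℚᵘ-/ i 1)) (ℚᵘP.<-respʳ-≃ (ℚᵘP.≃-sym (toℚᵘ-/ j 1))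
    (ℚᵘ.*<* (subst₂ ℤ._<_ (sym (ℤP.*-identityʳ i)) (sym (ℤP.*-identityʳ j)) i<j))))

fromℤ≤fromℤ∣∣ : ∀ i → fromℤ i ≤ fromℤ (+ ℤ.∣ i ∣)
fromℤ≤fromℤ∣∣ (+ n)    = ≤-refl
fromℤ≤fromℤ∣∣ -[1+ n ] = fromℤ-mono-≤ { -[1+ n ]} {+ suc n} ℤ.-≤+

i<j+1⇒i≤j : ∀ {i j} → i ℤ.< j ℤ.+ + 1 → i ℤ.≤ j
i<j+1⇒i≤j {i} {j} i<j+1 with j ℤP.<? i
... | yes j<i = ⊥-elim (ℤP.<-irrefl refl (ℤP.<-≤-trans i<j+1
                  (subst (ℤ._≤ i) (ℤP.+-comm (+ 1) j) (ℤP.i<j⇒suc[i]≤j j<i))))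
... | no  j≮i = ℤP.≮⇒≥ j≮i

i≤j⇒j≡i+∣j-i∣ : ∀ {i j} → i ℤ.≤ j → j ≡ i ℤ.+ + ℤ.∣ j ℤ.- i ∣
i≤j⇒j≡i+∣j-i∣ {i} {j} i≤j = trans (sym i+[j-i]≡j) (cong (λ k → i ℤ.+ k) (sym (ℤP.0≤i⇒+∣i∣≡i (ℤP.i≤j⇒0≤j-i i≤j))))
  where
  i+[j-i]≡j : i ℤ.+ (j ℤ.- i) ≡ j
  i+[j-i]≡j = ℤS.solve 2 (λ a b → a ℤS.:+ (b ℤS.:- a) ℤS.:= b) refl i j

∣p-q∣≡∣q-p∣ : ∀ p q → ∣ p - q ∣ ≡ ∣ q - p ∣
∣p-q∣≡∣q-p∣ p q = trans (cong ∣_∣ (ℚS.solve 2 (λ a b → a ℚS.:- b ℚS.:= ℚS.:- (b ℚS.:- a)) refl p q)) (∣-p∣≡∣p∣ (q - p))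

≤⇒∣p-q∣≡q-p : ∀ {p q} → p ≤ q → ∣ p - q ∣ ≡ q - p
≤⇒∣p-q∣≡q-p {p} {q} p≤q = begin
  ∣ p - q ∣      ≡⟨ ∣p-q∣≡∣q-p∣ p q ⟩
  ∣ q - p ∣      ≡⟨ 0≤p⇒∣p∣≡p (p≤q⇒0≤q-p p≤q) ⟩
  q - p          ∎
  where
  open ≡-Reasoning
  p≤q⇒0≤q-p : ∀ {p q} → p ≤ q → 0ℚ ≤ q - p
  p≤q⇒0≤q-p {p} {q} p≤q = subst (_≤ q - p) (+-inverseʳ p) (+-monoˡ-≤ (- p) p≤q)

∣p∣≡-p : ∀ {p} → p < 0ℚ → ∣ p ∣ ≡ - p
∣p∣≡-p {p} p<0 with ∣p∣≡p∨∣p∣≡-p p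
... | inj₁ ∣p∣≡p  = ⊥-elim (<-irrefl refl (<-≤-trans p<0 (∣p∣≡p⇒0≤p ∣p∣≡p)))
... | inj₂ ∣p∣≡-p = ∣p∣≡-p

p*[q*recip[p]]≡q : ∀ p q → 0ℚ < p ⊎ p < 0ℚ → p * (q * recip p) ≡ q
p*[q*recip[p]]≡q p q p≢0 = begin
  p * (q * recip p)  ≡⟨ ℚS.solve 3 (λ a b r → a ℚS.:* (b ℚS.:* r) ℚS.:= b ℚS.:* (a ℚS.:* r)) refl p q (recip p) ⟩
  q * (p * recip p)  ≡⟨ cong (q *_) (p*recip[p]≡1 p p≢0) ⟩
  q * 1ℚ             ≡⟨ *-identityʳ q ⟩
  q                  ∎
  where
  open ≡-Reasoning
  p*recip[p]≡1 : ∀ p → 0ℚ < p ⊎ p < 0ℚ → p * recip p ≡ 1ℚ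
  p*recip[p]≡1 (mkℚ (+ zero) _ _) (inj₁ (*<* (ℤ.+<+ ())))
  p*recip[p]≡1 (mkℚ (+ zero) _ _) (inj₂ (*<* (ℤ.+<+ ())))
  p*recip[p]≡1 p@(mkℚ (+ suc n) _ _) _ = *-inverseʳ p
  p*recip[p]≡1 p@(mkℚ -[1+ n ] _ _) _  = *-inverseʳ p

≤̄-refl : ∀ a → a ≤̄ a
≤̄-refl -∞      = -∞≤
≤̄-refl +∞      = ≤+∞
≤̄-refl (fin a) = fin≤ ≤-refl

≤̄-antisym : ∀ {a b} → a ≤̄ b → b ≤̄ a → a ≡ b
≤̄-antisym -∞≤        -∞≤        = refl
≤̄-antisym ≤+∞        ≤+∞        = refl
≤̄-antisym (fin≤ a≤b) (fin≤ b≤a) = cong fin (≤-antisym a≤b b≤a)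

fin≤⁻¹ : ∀ {a b} → fin a ≤̄ fin b → a ≤ b
fin≤⁻¹ (fin≤ a≤b) = a≤b

OrdConvex : (ℚ → Set) → Set
OrdConvex P = ∀ {a b c} → P a → P c → a ≤ b → b ≤ c → P b

-- If [lo, hi] ∋ z is shorter than [a, b], it cannot contain [a, b], so it reaches into it.
convex-bracket : ∀ {P} → OrdConvex P → ∀ {a b c z lo hi} → P a → P b → c < b - a →
                 P z → lo ≤ z → z ≤ hi → hi - lo ≤ c → P lo ⊎ P hi
convex-bracket conv {a} {b} {lo = lo} {hi} Pa Pb c<b-a Pz lo≤z z≤hi hi-lo≤c with a ≤? lo | hi ≤? b
... | yes a≤lo | _        = inj₁ (conv Pa Pz a≤lo lo≤z)
... | no  _    | yes hi≤b = inj₂ (conv Pz Pb z≤hi hi≤b)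
... | no  a≰lo | no  hi≰b = ⊥-elim (<-irrefl refl (<-≤-trans b-a<hi-lo (≤-trans hi-lo≤c (<⇒≤ c<b-a))))
  where
  b-a<hi-lo : b - a < hi - lo
  b-a<hi-lo = +-mono-< (≰⇒> hi≰b) (neg-antimono-< (≰⇒> a≰lo))

convex-product-bracket : ∀ {P} → OrdConvex P → ∀ {a b u x t y₁ y₂} → P a → P b → ∣ x ∣ * u < b - a →
                         0ℚ < x ⊎ x < 0ℚ → P (x * t) → y₁ ≤ t → t ≤ y₂ → y₂ - y₁ ≤ u →
                         P (x * y₁) ⊎ P (x * y₂)
convex-product-bracket conv {u = u} {x} {y₁ = y₁} {y₂} Pa Pb ∣x∣u<b-a (inj₁ 0<x) Pxt y₁≤t t≤y₂ y₂-y₁≤u =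
  convex-bracket conv Pa Pb ∣x∣u<b-a Pxt (*-monoˡ-≤-nonNeg x y₁≤t) (*-monoˡ-≤-nonNeg x t≤y₂) gap
  where
  instance
    x-nonNeg : ℚ.NonNegative x
    x-nonNeg = ℚ.nonNegative (<⇒≤ 0<x)
  gap : x * y₂ - x * y₁ ≤ ∣ x ∣ * u
  gap = subst₂ _≤_ (ℚS.solve 3 (λ a p q → a ℚS.:* (q ℚS.:- p) ℚS.:= a ℚS.:* q ℚS.:- a ℚS.:* p) refl x y₁ y₂)
                   (cong (_* u) (sym (0≤p⇒∣p∣≡p (<⇒≤ 0<x)))) (*-monoˡ-≤-nonNeg x y₂-y₁≤u)
convex-product-bracket conv {u = u} {x} {y₁ = y₁} {y₂} Pa Pb ∣x∣u<b-a (inj₂ x<0) Pxt y₁≤t t≤y₂ y₂-y₁≤u =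
  [ inj₂ , inj₁ ]′ (convex-bracket conv Pa Pb ∣x∣u<b-a Pxt (*-monoˡ-≤-nonPos x t≤y₂) (*-monoˡ-≤-nonPos x y₁≤t) gap)
  where
  instance
    x-nonPos : ℚ.NonPositive x
    x-nonPos = ℚ.nonPositive (<⇒≤ x<0)
    -x-nonNeg : ℚ.NonNegative (- x)
    -x-nonNeg = ℚ.nonNegative (neg-antimono-≤ (<⇒≤ x<0))
  gap : x * y₁ - x * y₂ ≤ ∣ x ∣ * u
  gap = subst₂ _≤_ (ℚS.solve 3 (λ a p q → (ℚS.:- a) ℚS.:* (q ℚS.:- p) ℚS.:= a ℚS.:* p ℚS.:- a ℚS.:* q) refl x y₁ y₂)
                   (cong (_* u) (sym (∣p∣≡-p x<0))) (*-monoˡ-≤-nonNeg (- x) y₂-y₁≤u)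

y≤[1+M]u⇒y-Mu≤u : ∀ M u {y} → y ≤ fromℤ (+ suc M) * u → y - fromℤ (+ M) * u ≤ u
y≤[1+M]u⇒y-Mu≤u M u {y} y≤[1+M]u = subst (y - Mu ≤_) [1+M]u-Mu≡u (+-monoˡ-≤ (- Mu) y≤[1+M]u)
  where
  Mu = fromℤ (+ M) * u
  [1+M]u-Mu≡u : fromℤ (+ suc M) * u - Mu ≡ u
  [1+M]u-Mu≡u = trans (cong (λ q → q * u - Mu) (fromℤ-homo-+ (+ 1) (+ M)))
    (ℚS.solve 2 (λ a v → (ℚS.con 1ℚ ℚS.:+ a) ℚS.:* v ℚS.:- a ℚS.:* v ℚS.:= v) refl (fromℤ (+ M)) u)

grid-cell : ∀ u s → 0ℚ ≤ s → ∀ N → s < fromℤ (+ N) * u →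
            Σ ℕ λ M → M ℕ.< N × fromℤ (+ M) * u ≤ s × s < fromℤ (+ suc M) * u
grid-cell u s 0≤s zero s<0 = ⊥-elim (<-irrefl refl (≤-<-trans 0≤s (subst (s <_) (*-zeroˡ u) s<0)))
grid-cell u s 0≤s (suc N) s<[N+1]u with s <? fromℤ (+ N) * u
... | yes s<Nu = let (M , M<N , Mu≤s , s<[M+1]u) = grid-cell u s 0≤s N s<Nu
                 in M , ℕP.m<n⇒m<1+n M<N , Mu≤s , s<[M+1]u
... | no  s≮Nu = N , ℕP.n<1+n N , ≮⇒≥ s≮Nu , s<[N+1]u

DiamGt-cases : ∀ {S c} → 0ℚ ≤ c → DiamGt S c →
               S -∞ ⊎ S +∞ ⊎ Σ ℚ λ a → Σ ℚ λ b → S (fin a) × S (fin b) × c < b - a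
DiamGt-cases 0≤c (inj₁ c<0) = ⊥-elim (<-irrefl refl (<-≤-trans c<0 0≤c))
DiamGt-cases _ (inj₂ (-∞ , _ , Sa , _ , _))            = inj₁ Sa
DiamGt-cases _ (inj₂ (+∞ , _ , Sa , _ , _))            = inj₂ (inj₁ Sa)
DiamGt-cases _ (inj₂ (fin _ , -∞ , _ , Sb , _))        = inj₁ Sb
DiamGt-cases _ (inj₂ (fin _ , +∞ , _ , Sb , _))        = inj₂ (inj₁ Sb)
DiamGt-cases {c = c} _ (inj₂ (fin a , fin b , Sa , Sb , fin< c<∣a-b∣)) with a ≤? b
... | yes a≤b = inj₂ (inj₂ (a , b , Sa , Sb , subst (c <_) (≤⇒∣p-q∣≡q-p a≤b) c<∣a-b∣))
... | no  a≰b = inj₂ (inj₂ (b , a , Sb , Sa ,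
                  subst (c <_) (trans (∣p-q∣≡∣q-p∣ a b) (≤⇒∣p-q∣≡q-p (<⇒≤ (≰⇒> a≰b)))) c<∣a-b∣))

module _ (fmt : Format) where
  open Fmt fmt

  βℚ : ℚ
  βℚ = fromℤ (+ β)

  β^n≢0 : ∀ n → NonZero (β ℕ.^ n)
  β^n≢0 n = ℕP.m^n≢0 β n

  pw-suc : ∀ k → pw (k ℤ.+ + 1) ≡ pw k * βℚ
  pw-suc (+ n) = begin
    fromℤ (+ (β ℕ.^ (n ℕ.+ 1)))   ≡⟨ cong (λ m → fromℤ (+ m)) β^[n+1]≡β^n*β ⟩
    fromℤ (+ (β ℕ.^ n ℕ.* β))      ≡⟨ cong fromℤ (ℤP.pos-* (β ℕ.^ n) β) ⟩
    fromℤ (+ (β ℕ.^ n) ℤ.* + β)    ≡⟨ fromℤ-homo-* (+ (β ℕ.^ n)) (+ β) ⟩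
    fromℤ (+ (β ℕ.^ n)) * βℚ       ∎
    where
    open ≡-Reasoning
    β^[n+1]≡β^n*β : β ℕ.^ (n ℕ.+ 1) ≡ β ℕ.^ n ℕ.* β
    β^[n+1]≡β^n*β = trans (cong (β ℕ.^_) (ℕP.+-comm n 1)) (ℕP.*-comm β (β ℕ.^ n))
  pw-suc -[1+ zero ]    = sym (1/a*b≡1/c (β ℕ.^ 1) β 1 {{β^n≢0 1}} refl)
  pw-suc -[1+ suc n ]   = sym (1/a*b≡1/c (β ℕ.^ suc (suc n)) β (β ℕ.^ suc n) {{β^n≢0 (suc (suc n))}} {{β^n≢0 (suc n)}} refl)

  pw-+ : ∀ k n → pw (k ℤ.+ + n) ≡ pw k * fromℤ (+ (β ℕ.^ n))
  pw-+ k zero    = trans (cong pw (ℤP.+-identityʳ k)) (sym (*-identityʳ (pw k)))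
  pw-+ k (suc n) = begin
    pw (k ℤ.+ + suc n)                    ≡⟨ cong pw (ℤS.solve 2 (λ i m → i ℤS.:+ (ℤS.con (+ 1) ℤS.:+ m)
                                                ℤS.:= (i ℤS.:+ m) ℤS.:+ ℤS.con (+ 1)) refl k (+ n)) ⟩
    pw ((k ℤ.+ + n) ℤ.+ + 1)              ≡⟨ pw-suc (k ℤ.+ + n) ⟩
    pw (k ℤ.+ + n) * βℚ                   ≡⟨ cong (_* βℚ) (pw-+ k n) ⟩
    pw k * fromℤ (+ (β ℕ.^ n)) * βℚ       ≡⟨ *-assoc (pw k) _ _ ⟩
    pw k * (fromℤ (+ (β ℕ.^ n)) * βℚ)     ≡⟨ cong (pw k *_) (sym (trans (cong fromℤ β^[1+n]≡β^n*β) (fromℤ-homo-* (+ (β ℕ.^ n)) (+ β)))) ⟩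
    pw k * fromℤ (+ (β ℕ.^ suc n))        ∎
    where
    open ≡-Reasoning
    β^[1+n]≡β^n*β : + (β ℕ.^ suc n) ≡ + (β ℕ.^ n) ℤ.* + β
    β^[1+n]≡β^n*β = trans (cong +_ (ℕP.*-comm β (β ℕ.^ n))) (ℤP.pos-* (β ℕ.^ n) β)

  pw-pos : ∀ k → 0ℚ < pw k
  pw-pos (+ n)    = fromℤ-mono-< (ℤ.+<+ (ℕP.m^n>0 β n))
  pw-pos -[1+ n ] = positive⁻¹ _ {{normalize-pos 1 (β ℕ.^ suc n) {{β^n≢0 (suc n)}}}}

  pw-positive : ∀ k → ℚ.Positive (pw k)
  pw-positive k = ℚ.positive (pw-pos k)

  pw-nonNegative : ∀ k → ℚ.NonNegative (pw k)
  pw-nonNegative k = ℚ.nonNegative (<⇒≤ (pw-pos k))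

  pw-mono-≤ : ∀ {i j} → i ℤ.≤ j → pw i ≤ pw j
  pw-mono-≤ {i} {j} i≤j = begin
    pw i                        ≡⟨ sym (*-identityʳ (pw i)) ⟩
    pw i * 1ℚ                   ≤⟨ *-monoˡ-≤-nonNeg (pw i) {{pw-nonNegative i}} (fromℤ-mono-≤ (ℤ.+≤+ (ℕP.m^n>0 β d))) ⟩
    pw i * fromℤ (+ (β ℕ.^ d))  ≡⟨ sym (pw-+ i d) ⟩
    pw (i ℤ.+ + d)              ≡⟨ cong pw (sym (i≤j⇒j≡i+∣j-i∣ i≤j)) ⟩
    pw j                        ∎
    where
    open ≤-Reasoning
    d = ℤ.∣ j ℤ.- i ∣

  pw<pw[1+] : ∀ i → pw i < pw (i ℤ.+ + 1)
  pw<pw[1+] i = begin-strict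
    pw i           ≡⟨ sym (*-identityʳ (pw i)) ⟩
    pw i * 1ℚ      <⟨ *-monoʳ-<-pos (pw i) {{pw-positive i}} (fromℤ-mono-< (ℤ.+<+ 2≤β)) ⟩
    pw i * βℚ      ≡⟨ sym (pw-suc i) ⟩
    pw (i ℤ.+ + 1) ∎
    where open ≤-Reasoning

  pw-cancel-< : ∀ {i j} → pw i < pw j → i ℤ.< j
  pw-cancel-< {i} {j} pwi<pwj with i ℤP.<? j
  ... | yes i<j = i<j
  ... | no  i≮j = ⊥-elim (<-irrefl refl (<-≤-trans pwi<pwj (pw-mono-≤ (ℤP.≮⇒≥ i≮j))))

  β^p*pw[Qof[e]]≡pw[e+1] : ∀ e → fromℤ (+ (β ℕ.^ p)) * pw (Qof e) ≡ pw (e ℤ.+ + 1)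
  β^p*pw[Qof[e]]≡pw[e+1] e = trans (*-comm _ (pw (Qof e))) (trans (sym (pw-+ (Qof e) p)) (cong pw Qof[e]+p≡e+1))
    where
    Qof[e]+p≡e+1 : Qof e ℤ.+ + p ≡ e ℤ.+ + 1
    Qof[e]+p≡e+1 = ℤS.solve 3 (λ a b c → ((a ℤS.:- b) ℤS.:+ c) ℤS.:+ b ℤS.:= a ℤS.:+ c) refl e (+ p) (+ 1)

  β^[p-1]*pw[Qof[e+1]]≡pw[e+1] : ∀ e → fromℤ (+ (β ℕ.^ (p ℕ.∸ 1))) * pw (Qof (e ℤ.+ + 1)) ≡ pw (e ℤ.+ + 1)
  β^[p-1]*pw[Qof[e+1]]≡pw[e+1] e =
    trans (*-comm _ (pw (Qof (e ℤ.+ + 1)))) (trans (sym (pw-+ (Qof (e ℤ.+ + 1)) (p ℕ.∸ 1))) (cong pw exponent))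
    where
    p≡[p-1]+1 : + p ≡ + (p ℕ.∸ 1) ℤ.+ + 1
    p≡[p-1]+1 = trans (cong +_ (sym (ℕP.m∸n+n≡m 1≤p))) (ℤP.pos-+ (p ℕ.∸ 1) 1)
    exponent : Qof (e ℤ.+ + 1) ℤ.+ + (p ℕ.∸ 1) ≡ e ℤ.+ + 1
    exponent = trans (cong (λ q → ((e ℤ.+ + 1) ℤ.- q ℤ.+ + 1) ℤ.+ + (p ℕ.∸ 1)) p≡[p-1]+1)
      (ℤS.solve 2 (λ a q → ((a ℤS.:+ ℤS.con (+ 1)) ℤS.:- (q ℤS.:+ ℤS.con (+ 1)) ℤS.:+ ℤS.con (+ 1)) ℤS.:+ q
                           ℤS.:= a ℤS.:+ ℤS.con (+ 1)) refl e (+ (p ℕ.∸ 1)))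

  -- Floating-point numbers

  InF-scaled : ∀ M e → M ℕ.< β ℕ.^ p → emin ℤ.≤ e → e ℤ.≤ emax → InF (fromℤ (+ M) * pw (Qof e))
  InF-scaled zero    e _ _ _           = inj₂ (*-zeroˡ (pw (Qof e)))
  InF-scaled (suc M) e M<β^p emin≤e e≤emax = inj₁ (+ suc M , e , ℕ.s≤s ℕ.z≤n , M<β^p , emin≤e , e≤emax , refl)

  InF-neg : ∀ {y} → InF y → InF (- y)
  InF-neg (inj₂ y≡0) = inj₂ (cong -_ y≡0)
  InF-neg (inj₁ (M , e , 0<∣M∣ , ∣M∣<β^p , emin≤e , e≤emax , refl)) =
    inj₁ (ℤ.- M , e , subst (0 ℕ.<_) (sym (ℤP.∣-i∣≡∣i∣ M)) 0<∣M∣ , subst (ℕ._< β ℕ.^ p) (sym (ℤP.∣-i∣≡∣i∣ M)) ∣M∣<β^p ,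
          emin≤e , e≤emax , trans (neg-distribˡ-* (fromℤ M) (pw (Qof e))) (cong (_* pw (Qof e)) (sym (fromℤ-homo‿- M))))

  IsFloatStar⇒≢0 : ∀ {y} → IsFloatStar y → 0ℚ < y ⊎ y < 0ℚ
  IsFloatStar⇒≢0 (+ zero , _ , () , _)
  IsFloatStar⇒≢0 (+ suc n , e , _ , _ , _ , _ , refl) =
    inj₁ (positive⁻¹ _ {{pos*pos⇒pos (fromℤ (+ suc n)) {{ℚ.positive (fromℤ-mono-< {+ 0} {+ suc n} (ℤ.+<+ (ℕ.s≤s ℕ.z≤n)))}}
                                       (pw (Qof e)) {{pw-positive (Qof e)}}}})
  IsFloatStar⇒≢0 (-[1+ n ] , e , _ , _ , _ , _ , refl) =
    inj₂ (negative⁻¹ _ {{neg*pos⇒neg (fromℤ -[1+ n ]) {{ℚ.negative (fromℤ-mono-< { -[1+ n ]} {+ 0} ℤ.-<+)}}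
                                       (pw (Qof e)) {{pw-positive (Qof e)}}}})

  InF⇒<pw[emax+1] : ∀ {y} → InF y → y < pw (emax ℤ.+ + 1)
  InF⇒<pw[emax+1] (inj₂ refl) = pw-pos (emax ℤ.+ + 1)
  InF⇒<pw[emax+1] (inj₁ (M , e , _ , ∣M∣<β^p , _ , e≤emax , refl)) = begin-strict
    fromℤ M * pw (Qof e)                   ≤⟨ *-monoʳ-≤-nonNeg (pw (Qof e)) {{pw-nonNegative (Qof e)}} (fromℤ≤fromℤ∣∣ M) ⟩
    fromℤ (+ ℤ.∣ M ∣) * pw (Qof e)         <⟨ *-monoˡ-<-pos (pw (Qof e)) {{pw-positive (Qof e)}} (fromℤ-mono-< (ℤ.+<+ ∣M∣<β^p)) ⟩
    fromℤ (+ (β ℕ.^ p)) * pw (Qof e)       ≡⟨ β^p*pw[Qof[e]]≡pw[e+1] e ⟩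
    pw (e ℤ.+ + 1)                         ≤⟨ pw-mono-≤ (ℤP.+-monoˡ-≤ (+ 1) e≤emax) ⟩
    pw (emax ℤ.+ + 1)                      ∎
    where open ≤-Reasoning

  IsE-bounds : ∀ {t e m} → IsE t e → ∣ t ∣ ≤ m → InF m → emin ℤ.≤ e × e ℤ.≤ emax × ∣ t ∣ < pw (e ℤ.+ + 1)
  IsE-bounds (inj₁ (pw[emin]≤∣t∣ , pw[e]≤∣t∣ , ∣t∣<pw[e+1])) ∣t∣≤m m∈F =
    i<j+1⇒i≤j (pw-cancel-< (≤-<-trans pw[emin]≤∣t∣ ∣t∣<pw[e+1])) ,
    i<j+1⇒i≤j (pw-cancel-< (≤-<-trans pw[e]≤∣t∣ (≤-<-trans ∣t∣≤m (InF⇒<pw[emax+1] m∈F)))) ,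
    ∣t∣<pw[e+1]
  IsE-bounds (inj₂ (∣t∣<pw[emin] , refl)) _ _ = ℤP.≤-refl , emin≤emax , <-trans ∣t∣<pw[emin] (pw<pw[1+] emin)

  pw[e+1]∈F : ∀ e → emin ℤ.≤ e → e ℤ.+ + 1 ℤ.≤ emax → InF (pw (e ℤ.+ + 1))
  pw[e+1]∈F e emin≤e e+1≤emax = subst InF (β^[p-1]*pw[Qof[e+1]]≡pw[e+1] e)
    (InF-scaled (β ℕ.^ (p ℕ.∸ 1)) (e ℤ.+ + 1) (ℕP.^-monoʳ-< β 2≤β p-1<p) (ℤP.≤-trans emin≤e (ℤP.i≤i+j e (+ 1))) e+1≤emax)
    where
    p-1<p : p ℕ.∸ 1 ℕ.< p
    p-1<p = ℕP.∸-monoʳ-< {p} {1} {0} (ℕ.s≤s ℕ.z≤n) 1≤p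

  [1+M]*pw[Qof[e]]≡pw[e+1] : ∀ e M → suc M ≡ β ℕ.^ p → fromℤ (+ suc M) * pw (Qof e) ≡ pw (e ℤ.+ + 1)
  [1+M]*pw[Qof[e]]≡pw[e+1] e M 1+M≡β^p = trans (cong (λ n → fromℤ (+ n) * pw (Qof e)) 1+M≡β^p) (β^p*pw[Qof[e]]≡pw[e+1] e)

  -- The grid point (M + 1) β^Q(e) fails to be a float only when M + 1 = β^p; it is then β^(e+1), a float
  -- of the next binade unless it exceeds max 𝔽, in which case max 𝔽 itself lies in between.
  float-between : ∀ {m} e M → InF m → emin ℤ.≤ e → e ℤ.≤ emax → M ℕ.< β ℕ.^ p →
                  ∀ s → s ≤ m → s < fromℤ (+ suc M) * pw (Qof e) →
                  Σ ℚ λ y → InF y × s ≤ y × y ≤ fromℤ (+ suc M) * pw (Qof e)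
  float-between {m} e M m∈F emin≤e e≤emax M<β^p s s≤m s<[1+M]u with suc M ℕ.<? β ℕ.^ p
  ... | yes 1+M<β^p = _ , InF-scaled (suc M) e 1+M<β^p emin≤e e≤emax , <⇒≤ s<[1+M]u , ≤-refl
  ... | no  1+M≮β^p with [1+M]*pw[Qof[e]]≡pw[e+1] e M (ℕP.≤-antisym M<β^p (ℕP.≮⇒≥ 1+M≮β^p)) | pw (e ℤ.+ + 1) ≤? m
  ...   | [1+M]u≡pw[e+1] | yes pw[e+1]≤m =
    pw (e ℤ.+ + 1) , pw[e+1]∈F e emin≤e e+1≤emax , <⇒≤ (subst (s <_) [1+M]u≡pw[e+1] s<[1+M]u) ,
    ≤-reflexive (sym [1+M]u≡pw[e+1])
    where
    e+1≤emax : e ℤ.+ + 1 ℤ.≤ emax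
    e+1≤emax = i<j+1⇒i≤j (pw-cancel-< (≤-<-trans pw[e+1]≤m (InF⇒<pw[emax+1] m∈F)))
  ...   | [1+M]u≡pw[e+1] | no  pw[e+1]≰m =
    m , m∈F , s≤m , <⇒≤ (subst (m <_) (sym [1+M]u≡pw[e+1]) (≰⇒> pw[e+1]≰m))

  FloatBracket : ℚ → ℚ → Set
  FloatBracket t u = Σ ℚ λ y₁ → Σ ℚ λ y₂ → InF y₁ × InF y₂ × y₁ ≤ t × t ≤ y₂ × y₂ - y₁ ≤ u

  float-bracket-nonNeg : ∀ {m} e → InF m → emin ℤ.≤ e → e ℤ.≤ emax →
                         ∀ s → 0ℚ ≤ s → s ≤ m → s < pw (e ℤ.+ + 1) → FloatBracket s (pw (Qof e))
  float-bracket-nonNeg e m∈F emin≤e e≤emax s 0≤s s≤m s<pw[e+1] =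
    let (M , M<β^p , Mu≤s , s<[1+M]u) = grid-cell (pw (Qof e)) s 0≤s (β ℕ.^ p)
                                          (subst (s <_) (sym (β^p*pw[Qof[e]]≡pw[e+1] e)) s<pw[e+1])
        (y , y∈F , s≤y , y≤[1+M]u) = float-between e M m∈F emin≤e e≤emax M<β^p s s≤m s<[1+M]u
    in  _ , y , InF-scaled M e M<β^p emin≤e e≤emax , y∈F , Mu≤s , s≤y , y≤[1+M]u⇒y-Mu≤u M (pw (Qof e)) y≤[1+M]u

  FloatBracket-neg : ∀ {t u} → FloatBracket t u → FloatBracket (- t) u
  FloatBracket-neg {u = u} (y₁ , y₂ , y₁∈F , y₂∈F , y₁≤t , t≤y₂ , y₂-y₁≤u) =
    - y₂ , - y₁ , InF-neg y₂∈F , InF-neg y₁∈F , neg-antimono-≤ t≤y₂ , neg-antimono-≤ y₁≤t ,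
    subst (_≤ u) (ℚS.solve 2 (λ a c → c ℚS.:- a ℚS.:= (ℚS.:- a) ℚS.:- (ℚS.:- c)) refl y₁ y₂) y₂-y₁≤u

  float-bracket : ∀ {t e m} → InF m → ∣ t ∣ ≤ m → IsE t e → FloatBracket t (pw (Qof e))
  float-bracket {t} {e} m∈F ∣t∣≤m t∈E with IsE-bounds t∈E ∣t∣≤m m∈F | ∣p∣≡p∨∣p∣≡-p t
  ... | emin≤e , e≤emax , ∣t∣<pw[e+1] | inj₁ ∣t∣≡t =
    float-bracket-nonNeg e m∈F emin≤e e≤emax t (∣p∣≡p⇒0≤p ∣t∣≡t) (subst (_≤ _) ∣t∣≡t ∣t∣≤m) (subst (_< _) ∣t∣≡t ∣t∣<pw[e+1])
  ... | emin≤e , e≤emax , ∣t∣<pw[e+1] | inj₂ ∣t∣≡-t =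
    subst (λ s → FloatBracket s (pw (Qof e))) (ℚS.solve 1 (λ a → ℚS.:- (ℚS.:- a) ℚS.:= a) refl t)
      (FloatBracket-neg (float-bracket-nonNeg e m∈F emin≤e e≤emax (- t)
        (subst (0ℚ ≤_) ∣t∣≡-t (0≤∣p∣ t)) (subst (_≤ _) ∣t∣≡-t ∣t∣≤m) (subst (_< _) ∣t∣≡-t ∣t∣<pw[e+1])))

  -- Rounding and floating-point intervals

  rounding-fixes-floats : ∀ {fl} → IsRounding fl → ∀ {w} → InF̄ w → fl w ≡ w
  rounding-fixes-floats (_ , rounds) {w} w∈F with rounds w
  ... | inj₁ (_ , fl[w]≤w , maximal) = ≤̄-antisym fl[w]≤w (maximal w w∈F (≤̄-refl w))
  ... | inj₂ (_ , w≤fl[w] , minimal) = ≤̄-antisym (minimal w w∈F (≤̄-refl w)) w≤fl[w]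

  rounding-preimage-convex : ∀ {fl Z} → IsRounding fl → IsFPInterval Z → OrdConvex (λ w → Z (fl (fin w)))
  rounding-preimage-convex {fl} (mono , rounds) (X , X-interval , Z⇔X∩F) {b = b} Za Zc a≤b b≤c =
    proj₂ (Z⇔X∩F (fl (fin b))) (X-fl[b] , [ proj₁ , proj₁ ]′ (rounds (fin b)))
    where
    X-fl[b] : X (fl (fin b))
    X-fl[b] = X-interval _ _ _ (proj₁ (proj₁ (Z⇔X∩F _) Za)) (proj₁ (proj₁ (Z⇔X∩F _) Zc))
                (mono _ _ (fin≤ a≤b)) (mono _ _ (fin≤ b≤c))

  IsĒ-+∞/̄ : ∀ x e → ¬ IsĒ (+∞ /̄ x) e
  IsĒ-+∞/̄ x e with 0ℚ ℚ.<? x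
  ... | yes _ = λ ()
  ... | no  _ = λ ()

  IsĒ--∞/̄ : ∀ x e → ¬ IsĒ (-∞ /̄ x) e
  IsĒ--∞/̄ x e with 0ℚ ℚ.<? x
  ... | yes _ = λ ()
  ... | no  _ = λ ()

  feasible-via-+∞ : ∀ {fl Z x} → 0ℚ < x ⊎ x < 0ℚ → Z (fl +∞) → Feasible fl Z (fin x)
  feasible-via-+∞ (inj₁ 0<x) Z[fl[+∞]] = +∞ , tt , +∞ , pos×+∞ 0<x , Z[fl[+∞]]
  feasible-via-+∞ (inj₂ x<0) Z[fl[+∞]] = -∞ , tt , +∞ , neg×-∞ x<0 , Z[fl[+∞]]

  feasible-via--∞ : ∀ {fl Z x} → 0ℚ < x ⊎ x < 0ℚ → Z (fl -∞) → Feasible fl Z (fin x)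
  feasible-via--∞ (inj₁ 0<x) Z[fl[-∞]] = -∞ , tt , -∞ , pos×-∞ 0<x , Z[fl[-∞]]
  feasible-via--∞ (inj₂ x<0) Z[fl[-∞]] = +∞ , tt , -∞ , neg×+∞ x<0 , Z[fl[-∞]]

  feasible-via-float : ∀ {fl Z x y} → InF y → Z (fl (fin (x * y))) → Feasible fl Z (fin x)
  feasible-via-float {y = y} y∈F Z[fl[xy]] = fin y , y∈F , _ , fin×fin , Z[fl[xy]]

  feasible-from-bracket : ∀ {fl Z x z u a b} → IsRounding fl → IsFPInterval Z → IsFloatStar x → Z (fin z) →
                          FloatBracket (z * recip x) u → Z (fl (fin a)) → Z (fl (fin b)) → ∣ x ∣ * u < b - a →
                          Feasible fl Z (fin x)
  feasible-from-bracket {fl} {Z} {x} {z} R I@(_ , _ , Z⇔X∩F) x∈F* z∈Z (y₁ , y₂ , y₁∈F , y₂∈F , y₁≤t , t≤y₂ , gap) Za Zb ∣x∣u<b-a =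
    [ feasible-via-float {fl} {Z} y₁∈F , feasible-via-float {fl} {Z} y₂∈F ]′
      (convex-product-bracket (rounding-preimage-convex R I) Za Zb ∣x∣u<b-a x≢0 Z[fl[x*[z/x]]] y₁≤t t≤y₂ gap)
    where
    x≢0 = IsFloatStar⇒≢0 x∈F*
    Z[fl[x*[z/x]]] : Z (fl (fin (x * (z * recip x))))
    Z[fl[x*[z/x]]] = subst Z (sym (trans (cong (λ w → fl (fin w)) (p*[q*recip[p]]≡q x z x≢0))
                                         (rounding-fixes-floats R (proj₂ (proj₁ (Z⇔X∩F (fin z)) z∈Z))))) z∈Z

mainTheorem10 : (fmt : Format) → let open Fmt fmt in
    (fl : ℚ̄ → ℚ̄) → IsRounding fl →
    (Z : ℚ̄ → Set) → IsFPInterval Z →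
    (x : ℚ) → IsFloatStar x →
    (z : ℚ̄) → Z z →
    (m : ℚ) → IsMaxF m → ∣ z /̄ x ∣̄ ≤̄ fin m →
    (e : ℤ) → IsĒ (z /̄ x) e →
    DiamGt (λ w → Z (fl w)) (∣ x ∣ * pw (Qof e)) →
    Feasible fl Z (fin x)
mainTheorem10 fmt fl R Z I x x∈F* -∞ _ _ _ _ e z/x∈E _ = ⊥-elim (IsĒ--∞/̄ fmt x e z/x∈E)
mainTheorem10 fmt fl R Z I x x∈F* +∞ _ _ _ _ e z/x∈E _ = ⊥-elim (IsĒ-+∞/̄ fmt x e z/x∈E)
mainTheorem10 fmt fl R Z I x x∈F* (fin z) z∈Z m (m∈F , _) ∣z/x∣≤m e z/x∈E diam
  with DiamGt-cases (0≤∣x∣*u) diam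
  where
  open Fmt fmt
  0≤∣x∣*u : 0ℚ ≤ ∣ x ∣ * pw (Qof e)
  0≤∣x∣*u = nonNegative⁻¹ _ {{nonNeg*nonNeg⇒nonNeg ∣ x ∣ {{∣-∣-nonNeg x}} (pw (Qof e)) {{pw-nonNegative fmt (Qof e)}}}}
... | inj₁ Z[fl[-∞]] = feasible-via--∞ fmt {fl} {Z} (IsFloatStar⇒≢0 fmt x∈F*) Z[fl[-∞]]
... | inj₂ (inj₁ Z[fl[+∞]]) = feasible-via-+∞ fmt {fl} {Z} (IsFloatStar⇒≢0 fmt x∈F*) Z[fl[+∞]]
... | inj₂ (inj₂ (a , b , Za , Zb , ∣x∣u<b-a)) =
  feasible-from-bracket fmt R I x∈F* z∈Z (float-bracket fmt m∈F (fin≤⁻¹ ∣z/x∣≤m) z/x∈E) Za Zb ∣x∣u<b-a
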